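{- For fixed integers $\ell \geq 1$ and $q \geq 2$, the sequences $\{|G(i)|\}_{i=1}^{\infty}$ and $\{|H(i)|\}_{i = 1}^\infty$ are both decreasing, where \begin{align*} G(i) &= \frac{ (-1)^i\, r\!\left(q^{ -2^{i+1}}\right) \prod_{j = 0}^{i-1} s\!\left(q^{ -2^{j+1}}\right)}{ \prod_{k = 0}^i \left(1 - q^{1-2^{k+1}}\right)}, & r(x) &= qx^{2\ell+1} - x^{4\ell} + x^{5\ell} - qx^{5\ell+1} +x^{6\ell}, \\ s(x) &= 1 - qx^{1-\ell} + x^{ -\ell}, & H(i) &= \frac{ (-1)^i\, u\!\left(q^{ -2^{i+1}}\right) \prod_{j = 0}^{i-1} v\!\left(q^{ -2^{j+1}}\right) }{ \prod_{k = 0}^i \left(1 - q^{1-2^{k+1}}\right)}, \\ u(x) &= qx^{4\ell+1} - x^{5\ell} + qx^{5\ell+1} - x^{6\ell}, & v(x) &= 1 - qx^{1-\ell} + x^{ -\ell} - qx^{1-2\ell} + x^{ -2\ell}. \end{align*} -}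

module Defs where

open import Data.Nat as ℕ using (ℕ; zero; suc)
open import Data.Integer as ℤ using (ℤ; +_; -[1+_])
open import Data.Rational
open import Data.Rational.Properties using (_≟_)
open import Relation.Nullary using (yes; no)

-- Total reciprocal on ℚ (junk value 0 at 0; only ever applied to nonzero arguments below).
inv : ℚ → ℚ
inv p with p ≟ 0ℚ
... | yes _ = 0ℚ
... | no p≢0 = 1/_ p {{≢-nonZero p≢0}}

infixr 8 _^ℕ_
_^ℕ_ : ℚ → ℕ → ℚ
x ^ℕ zero = 1ℚ
x ^ℕ suc n = x * (x ^ℕ n)

infixr 8 _^ℤ_
_^ℤ_ : ℚ → ℤ → ℚ
x ^ℤ (+ n) = x ^ℕ n
x ^ℤ -[1+ n ] = inv (x ^ℕ suc n)

nat : ℕ → ℚ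
nat n = (+ n) / 1

prod : ℕ → (ℕ → ℚ) → ℚ
prod zero f = 1ℚ
prod (suc n) f = prod n f * f n

_⊖ℤ_ : ℕ → ℕ → ℤ
a ⊖ℤ b = (+ a) ℤ.- (+ b)

module _ (ℓ q : ℕ) where
  private
    Q : ℚ
    Q = nat q
    _^_ : ℚ → ℕ → ℚ
    _^_ = _^ℕ_

  r : ℚ → ℚ
  r x = Q * x ^ (2 ℕ.* ℓ ℕ.+ 1) - x ^ (4 ℕ.* ℓ) + x ^ (5 ℕ.* ℓ)
        - Q * x ^ (5 ℕ.* ℓ ℕ.+ 1) + x ^ (6 ℕ.* ℓ)

  s : ℚ → ℚ
  s x = 1ℚ - Q * x ^ℤ (1 ⊖ℤ ℓ) + x ^ℤ (0 ⊖ℤ ℓ)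

  u : ℚ → ℚ
  u x = Q * x ^ (4 ℕ.* ℓ ℕ.+ 1) - x ^ (5 ℕ.* ℓ) + Q * x ^ (5 ℕ.* ℓ ℕ.+ 1)
        - x ^ (6 ℕ.* ℓ)

  v : ℚ → ℚ
  v x = 1ℚ - Q * x ^ℤ (1 ⊖ℤ ℓ) + x ^ℤ (0 ⊖ℤ ℓ)
        - Q * x ^ℤ (1 ⊖ℤ (2 ℕ.* ℓ)) + x ^ℤ (0 ⊖ℤ (2 ℕ.* ℓ))

  pt : ℕ → ℚ
  pt j = Q ^ℤ (0 ⊖ℤ (2 ℕ.^ (j ℕ.+ 1)))

  denom : ℕ → ℚ
  denom i = prod (suc i) (λ k → 1ℚ - Q ^ℤ (1 ⊖ℤ (2 ℕ.^ (k ℕ.+ 1))))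

  sign : ℕ → ℚ
  sign i = (- 1ℚ) ^ i

  G : ℕ → ℚ
  G i = (sign i * r (pt i) * prod i (λ j → s (pt j))) * inv (denom i)

  H : ℕ → ℚ
  H i = (sign i * u (pt i) * prod i (λ j → v (pt j))) * inv (denom i)

module Submission where

-- Write ℓ = m + 1, Q = q, y = q^(2^(i+1)) (so the i-th sample point is x = 1/y) and P = y^m.
-- Since G(i+1) = -G(i) · (r(x²) / r(x)) · s(x) / (1 - Q x²), the claim |G(i+1)| < |G(i)| follows
-- from  |r(x²)| · s(x) < |r(x)| · (1 - Q x²)  (ratio-criterion; likewise for H with u, v).
-- Multiplying r, u by y⁶P⁶ turns the Laurent polynomials r, u, s, v into ordinary polynomials
-- R, U, S, V in Q, y, P (Clearing), and the comparison becomes the polynomial inequality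
--   R(Q,y²,P²) · S(Q,y,P) < R(Q,y,P) · (y² - Q) · y⁴P⁶          (cleared-comparison).
-- For Q ≥ 2, y ≥ Q², P ≥ 1 this follows from the bounds  y³P⁴ ≤ R ≤ (Q+1)y³P⁴,  S ≤ 2yP
-- (Estimates) and the margin  2(Q+1) < P(y² - Q)  (Consecutive); for H one uses instead
-- yP² ≤ U ≤ 2QyP²,  V ≤ 3y²P²  and  6Q < yP²(y² - Q).  Each of these polynomial inequalities is
-- proved by a positivity certificate (Cert): the gap is written as sums and products of
-- quantities known to be nonnegative, and the ring solver checks the identity.
-- Since y ≥ Q² holds at every sample point, the comparison holds already from i = 0 on.

open import Defs
open import Data.Nat using (ℕ; suc; _≥_)
open import Data.Rational using (∣_∣; _<_)
open import Data.Product using (_×_)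

open import Data.Nat as ℕ using (zero; z≤n; s≤s)
import Data.Nat.Properties as ℕ
import Data.Nat.Coprimality as Coprime
open import Data.Integer as ℤ using (+_)
import Data.Integer.Properties as ℤ
open import Data.Rational hiding (_≥_)
open import Data.Rational.Properties
open import Data.Product using (_,_)
open import Data.Bool.Base using (Bool; true; false; _∧_; _∨_; T)
open import Data.List.Base using (_∷_; [])
open import Data.Maybe.Base using (Maybe; just; nothing)
open import Level using (0ℓ)
open import Relation.Nullary using (yes; no; contradiction)
open import Relation.Binary.PropositionalEquality
open import Algebra.Bundles using (CommutativeRing)
import Tactic.RingSolver.Core.AlmostCommutativeRing as ACR
open import Tactic.RingSolver using (solve)

-- ℚ as a ring for the reflective ring solver; its power function _^_ is the one the solver
-- understands, so polynomials below are written with it.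
ℚ-ring : ACR.AlmostCommutativeRing 0ℓ 0ℓ
ℚ-ring = ACR.fromCommutativeRing +-*-commutativeRing isZero
  where
  isZero : (x : ℚ) → Maybe (0ℚ ≡ x)
  isZero x with 0ℚ ≟ x
  ... | yes 0≡x = just 0≡x
  ... | no _ = nothing

open ACR.AlmostCommutativeRing ℚ-ring using (_^_)
open import Algebra.Properties.CommutativeSemiring.Exp.TCOptimised
  (CommutativeRing.commutativeSemiring +-*-commutativeRing) using (^-homo-*; ^-assocʳ; ^-distrib-*)
open import Algebra.Properties.CommutativeSemigroup
  (CommutativeRing.*-commutativeSemigroup +-*-commutativeRing) using (x∙yz≈y∙xz; x∙yz≈xz∙y; xy∙z≈xz∙y)

cong₄ : ∀ (f : ℚ → ℚ → ℚ → ℚ → ℚ) {a a′ b b′ c c′ d d′} →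
        a ≡ a′ → b ≡ b′ → c ≡ c′ → d ≡ d′ → f a b c d ≡ f a′ b′ c′ d′
cong₄ f refl refl refl refl = refl

cong₅ : ∀ (f : ℚ → ℚ → ℚ → ℚ → ℚ → ℚ) {a a′ b b′ c c′ d d′ e e′} →
        a ≡ a′ → b ≡ b′ → c ≡ c′ → d ≡ d′ → e ≡ e′ → f a b c d e ≡ f a′ b′ c′ d′ e′
cong₅ f refl refl refl refl refl = refl

nat≡mkℚ : ∀ k → nat k ≡ mkℚ (+ k) 0 (Coprime.sym (Coprime.1-coprimeTo k))
nat≡mkℚ k = normalize-coprime (Coprime.sym (Coprime.1-coprimeTo k))

nat-mono : ∀ {m n} → m ℕ.≤ n → nat m ≤ nat n
nat-mono {m} {n} m≤n rewrite nat≡mkℚ m | nat≡mkℚ n =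
  *≤* (subst₂ ℤ._≤_ (sym (ℤ.*-identityʳ (+ m))) (sym (ℤ.*-identityʳ (+ n))) (ℤ.+≤+ m≤n))

+-nonNeg : ∀ {a b} → 0ℚ ≤ a → 0ℚ ≤ b → 0ℚ ≤ a + b
+-nonNeg {a} {b} 0≤a 0≤b =
  nonNegative⁻¹ _ {{nonNeg+nonNeg⇒nonNeg a {{nonNegative 0≤a}} b {{nonNegative 0≤b}}}}

*-nonNeg : ∀ {a b} → 0ℚ ≤ a → 0ℚ ≤ b → 0ℚ ≤ a * b
*-nonNeg {a} {b} 0≤a 0≤b =
  nonNegative⁻¹ _ {{nonNeg*nonNeg⇒nonNeg a {{nonNegative 0≤a}} b {{nonNegative 0≤b}}}}

+-pos : ∀ {a b} → 0ℚ < a → 0ℚ ≤ b → 0ℚ < a + b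
+-pos {a} {b} 0<a 0≤b = positive⁻¹ _ {{pos+nonNeg⇒pos a {{positive 0<a}} b {{nonNegative 0≤b}}}}

+-pos′ : ∀ {a b} → 0ℚ ≤ a → 0ℚ < b → 0ℚ < a + b
+-pos′ {a} {b} 0≤a 0<b = positive⁻¹ _ {{nonNeg+pos⇒pos a {{nonNegative 0≤a}} b {{positive 0<b}}}}

*-pos : ∀ {a b} → 0ℚ < a → 0ℚ < b → 0ℚ < a * b
*-pos {a} {b} 0<a 0<b = positive⁻¹ _ {{pos*pos⇒pos a {{positive 0<a}} b {{positive 0<b}}}}

^-nonNeg : ∀ {a} → 0ℚ ≤ a → ∀ n → 0ℚ ≤ a ^ n
^-nonNeg 0≤a zero = nonNegative⁻¹ 1ℚ
^-nonNeg 0≤a (suc zero) = 0≤a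
^-nonNeg 0≤a (suc (suc n)) = *-nonNeg (^-nonNeg 0≤a (suc n)) 0≤a

^-pos : ∀ {a} → 0ℚ < a → ∀ n → 0ℚ < a ^ n
^-pos 0<a zero = positive⁻¹ 1ℚ
^-pos 0<a (suc zero) = 0<a
^-pos 0<a (suc (suc n)) = *-pos (^-pos 0<a (suc n)) 0<a

*-cancelʳ-pos : ∀ {a b} → 0ℚ < b → 0ℚ < a * b → 0ℚ < a
*-cancelʳ-pos {a} {b} 0<b 0<ab =
  *-cancelʳ-<-nonNeg b {{nonNegative (<⇒≤ 0<b)}} (subst (_< a * b) (sym (*-zeroˡ b)) 0<ab)

*-cancelʳ-nonNeg : ∀ {a b} → 0ℚ < b → 0ℚ ≤ a * b → 0ℚ ≤ a
*-cancelʳ-nonNeg {a} {b} 0<b 0≤ab =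
  *-cancelʳ-≤-pos b {{positive 0<b}} (subst (_≤ a * b) (sym (*-zeroˡ b)) 0≤ab)

*-mono-≤-nonNeg : ∀ {a a′ b b′} → 0ℚ ≤ a → a ≤ a′ → 0ℚ ≤ b′ → b ≤ b′ → a * b ≤ a′ * b′
*-mono-≤-nonNeg {a} {a′} {b} {b′} 0≤a a≤a′ 0≤b′ b≤b′ =
  ≤-trans (*-monoˡ-≤-nonNeg a {{nonNegative 0≤a}} b≤b′) (*-monoʳ-≤-nonNeg b′ {{nonNegative 0≤b′}} a≤a′)

pos⇒≢0 : ∀ {a} → 0ℚ < a → a ≢ 0ℚ
pos⇒≢0 0<a refl = <-irrefl refl 0<a

inv-cancelˡ : ∀ {a} → a ≢ 0ℚ → inv a * a ≡ 1ℚ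
inv-cancelˡ {a} a≢0 with a ≟ 0ℚ
... | yes a≡0 = contradiction a≡0 a≢0
... | no a≢0′ = *-inverseˡ a {{≢-nonZero a≢0′}}

inv-pos : ∀ {a} → 0ℚ < a → 0ℚ < inv a
inv-pos {a} 0<a = *-cancelʳ-pos 0<a (subst (0ℚ <_) (sym (inv-cancelˡ (pos⇒≢0 0<a))) (positive⁻¹ 1ℚ))

inv-unique : ∀ a {z} → a * z ≡ 1ℚ → inv a ≡ z
inv-unique a {z} az≡1 = begin
  inv a              ≡⟨ sym (*-identityʳ (inv a)) ⟩
  inv a * 1ℚ         ≡⟨ cong (inv a *_) (sym az≡1) ⟩
  inv a * (a * z)    ≡⟨ sym (*-assoc (inv a) a z) ⟩
  inv a * a * z      ≡⟨ cong (_* z) (inv-cancelˡ a≢0) ⟩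
  1ℚ * z             ≡⟨ *-identityˡ z ⟩
  z                  ∎
  where
  open ≡-Reasoning
  a≢0 : a ≢ 0ℚ
  a≢0 refl = 1≢0 (trans (sym az≡1) (*-zeroˡ z))

*-inv-cancel : ∀ u {w} → 0ℚ < w → u * inv w * w ≡ u
*-inv-cancel u {w} 0<w =
  trans (*-assoc u (inv w) w) (trans (cong (u *_) (inv-cancelˡ (pos⇒≢0 0<w))) (*-identityʳ u))

^ℕ≡^ : ∀ x n → x ^ℕ n ≡ x ^ n
^ℕ≡^ x zero = refl
^ℕ≡^ x (suc zero) = *-identityʳ x
^ℕ≡^ x (suc (suc n)) = trans (cong (x *_) (^ℕ≡^ x (suc n))) (*-comm x (x ^ suc n))

^ℕ-+ : ∀ x a b → x ^ℕ (a ℕ.+ b) ≡ x ^ℕ a * x ^ℕ b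
^ℕ-+ x a b = begin
  x ^ℕ (a ℕ.+ b)    ≡⟨ ^ℕ≡^ x (a ℕ.+ b) ⟩
  x ^ (a ℕ.+ b)     ≡⟨ ^-homo-* x a b ⟩
  x ^ a * x ^ b     ≡⟨ sym (cong₂ _*_ (^ℕ≡^ x a) (^ℕ≡^ x b)) ⟩
  x ^ℕ a * x ^ℕ b   ∎
  where open ≡-Reasoning

-- x^(b·a) = (x^a)^b, with the outer power in the solver's form.
^ℕ-*-exponent : ∀ x a b → x ^ℕ (b ℕ.* a) ≡ (x ^ℕ a) ^ b
^ℕ-*-exponent x a b = begin
  x ^ℕ (b ℕ.* a)    ≡⟨ ^ℕ≡^ x (b ℕ.* a) ⟩
  x ^ (b ℕ.* a)     ≡⟨ cong (x ^_) (ℕ.*-comm b a) ⟩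
  x ^ (a ℕ.* b)     ≡⟨ sym (^-assocʳ x a b) ⟩
  (x ^ a) ^ b       ≡⟨ cong (_^ b) (sym (^ℕ≡^ x a)) ⟩
  (x ^ℕ a) ^ b      ∎
  where open ≡-Reasoning

^ℕ-distrib-* : ∀ x y n → (x * y) ^ℕ n ≡ x ^ℕ n * y ^ℕ n
^ℕ-distrib-* x y n = begin
  (x * y) ^ℕ n      ≡⟨ ^ℕ≡^ (x * y) n ⟩
  (x * y) ^ n       ≡⟨ ^-distrib-* x y n ⟩
  x ^ n * y ^ n     ≡⟨ sym (cong₂ _*_ (^ℕ≡^ x n) (^ℕ≡^ y n)) ⟩
  x ^ℕ n * y ^ℕ n   ∎
  where open ≡-Reasoning

^ℕ-inverse : ∀ x y → x * y ≡ 1ℚ → ∀ n → x ^ℕ n * y ^ℕ n ≡ 1ℚ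
^ℕ-inverse x y xy≡1 n =
  trans (sym (^ℕ-distrib-* x y n)) (trans (cong (_^ℕ n) xy≡1) (1^ℕ n))
  where
  1^ℕ : ∀ k → 1ℚ ^ℕ k ≡ 1ℚ
  1^ℕ zero = refl
  1^ℕ (suc k) = trans (*-identityˡ _) (1^ℕ k)

^ℕ-pos : ∀ {x} → 0ℚ < x → ∀ n → 0ℚ < x ^ℕ n
^ℕ-pos {x} 0<x n = subst (0ℚ <_) (sym (^ℕ≡^ x n)) (^-pos 0<x n)

^ℕ-≥1 : ∀ {x} → 1ℚ ≤ x → ∀ n → 1ℚ ≤ x ^ℕ n
^ℕ-≥1 1≤x zero = ≤-refl
^ℕ-≥1 1≤x (suc n) =
  *-mono-≤-nonNeg (nonNegative⁻¹ 1ℚ) 1≤x (≤-trans (nonNegative⁻¹ 1ℚ) (^ℕ-≥1 1≤x n)) (^ℕ-≥1 1≤x n)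

-- A certificate that a rational expression is nonnegative: it is assembled by sums, products
-- and powers from quantities already known to be nonnegative or positive and from numerals.
-- Its index is the certified expression itself, so the ring solver can compare it with a gap.
infixl 6 _⊕_
infixl 7 _⊗_
infixr 8 _⊛_

data Cert : ℚ → Set where
  ≥0  : ∀ {a} → 0ℚ ≤ a → Cert a
  >0  : ∀ {a} → 0ℚ < a → Cert a
  #_  : ∀ n → Cert (nat n)
  _⊕_ : ∀ {a b} → Cert a → Cert b → Cert (a + b)
  _⊗_ : ∀ {a b} → Cert a → Cert b → Cert (a * b)
  _⊛_ : ∀ {a} → Cert a → ∀ n → Cert (a ^ n)

strict : ∀ {a} → Cert a → Bool
strict (≥0 _) = false
strict (>0 _) = true
strict (# zero) = false
strict (# suc _) = true
strict (c ⊕ d) = strict c ∨ strict d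
strict (c ⊗ d) = strict c ∧ strict d
strict (c ⊛ _) = strict c

cert-nonNeg : ∀ {a} → Cert a → 0ℚ ≤ a
cert-nonNeg (≥0 0≤a) = 0≤a
cert-nonNeg (>0 0<a) = <⇒≤ 0<a
cert-nonNeg (# n) = nonNegative⁻¹ _ {{normalize-nonNeg n 1}}
cert-nonNeg (c ⊕ d) = +-nonNeg (cert-nonNeg c) (cert-nonNeg d)
cert-nonNeg (c ⊗ d) = *-nonNeg (cert-nonNeg c) (cert-nonNeg d)
cert-nonNeg (c ⊛ n) = ^-nonNeg (cert-nonNeg c) n

cert-pos : ∀ {a} (c : Cert a) → T (strict c) → 0ℚ < a
cert-pos (>0 0<a) _ = 0<a
cert-pos (# suc n) _ = positive⁻¹ _ {{normalize-pos (suc n) 1}}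
cert-pos (c ⊕ d) s with strict c in eq
... | true = +-pos (cert-pos c (subst T (sym eq) _)) (cert-nonNeg d)
... | false = +-pos′ (cert-nonNeg c) (cert-pos d s)
cert-pos (c ⊗ d) s with strict c in eq
... | true = *-pos (cert-pos c (subst T (sym eq) _)) (cert-pos d s)
cert-pos (c ⊛ n) s = ^-pos (cert-pos c s) n

≤-by : ∀ {a b t} → Cert t → b ≡ a + t → a ≤ b
≤-by {a} {b} {t} c b≡a+t =
  subst₂ _≤_ (+-identityʳ a) (sym b≡a+t) (+-monoʳ-≤ a (cert-nonNeg c))

<-by : ∀ {a b t} (c : Cert t) {_ : T (strict c)} → b ≡ a + t → a < b
<-by {a} {b} {t} c {s} b≡a+t =
  subst₂ _<_ (+-identityʳ a) (sym b≡a+t) (+-monoʳ-< a (cert-pos c s))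

gap : ∀ {a b} → a ≤ b → 0ℚ ≤ b - a
gap {a} {b} a≤b = subst (_≤ b - a) (+-inverseʳ a) (+-monoˡ-≤ (- a) a≤b)

gap< : ∀ {a b} → a < b → 0ℚ < b - a
gap< {a} {b} a<b = subst (_< b - a) (+-inverseʳ a) (+-monoˡ-< (- a) a<b)

-- At a point x with x·y = 1, write P = y^m and p = x^m, so that x^ℓ = x·p (ℓ = m + 1).
-- The polynomials below are INLINE so that the ring solver sees through them.

r̂ û : ℚ → ℚ → ℚ → ℚ
r̂ Q x p = Q * ((x * p) ^ 2 * x) - (x * p) ^ 4 + (x * p) ^ 5 - Q * ((x * p) ^ 5 * x) + (x * p) ^ 6
û Q x p = Q * ((x * p) ^ 4 * x) - (x * p) ^ 5 + Q * ((x * p) ^ 5 * x) - (x * p) ^ 6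
{-# INLINE r̂ #-}
{-# INLINE û #-}

-- The clearing factor y⁶P⁶, and r, u, s, v after clearing, as polynomials in Q, y and P.
E : ℚ → ℚ → ℚ
E y P = y ^ 6 * P ^ 6
{-# INLINE E #-}

R U S V : ℚ → ℚ → ℚ → ℚ
R Q y P = Q * y ^ 3 * P ^ 4 - y ^ 2 * P ^ 2 + y * P - Q * P + 1ℚ
U Q y P = Q * y * P ^ 2 - y * P + Q * P - 1ℚ
S Q y P = 1ℚ - Q * P + y * P
V Q y P = 1ℚ - Q * P + y * P - Q * (y * P ^ 2) + y * (y * P ^ 2)
{-# INLINE R #-}
{-# INLINE U #-}
{-# INLINE S #-}
{-# INLINE V #-}

-- r̂·E and û·E expanded as polynomials in y, P and the products a = x·y, b = p·P.
Rₕ Uₕ : ℚ → ℚ → ℚ → ℚ → ℚ → ℚ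
Rₕ Q y P a b = Q * a ^ 3 * b ^ 2 * (y ^ 3 * P ^ 4) - a ^ 4 * b ^ 4 * (y ^ 2 * P ^ 2)
               + a ^ 5 * b ^ 5 * (y * P) - Q * a ^ 6 * b ^ 5 * P + a ^ 6 * b ^ 6
Uₕ Q y P a b = Q * a ^ 5 * b ^ 4 * (y * P ^ 2) - a ^ 5 * b ^ 5 * (y * P)
               + Q * a ^ 6 * b ^ 5 * P - a ^ 6 * b ^ 6
{-# INLINE Rₕ #-}
{-# INLINE Uₕ #-}

-- With x·y = p·P = 1, expanding r̂·E and û·E and setting these products to 1 clears them.
module _ {Q x y p P : ℚ} (xy≡1 : x * y ≡ 1ℚ) (pP≡1 : p * P ≡ 1ℚ) where
  open ≡-Reasoning

  r̂-cleared : r̂ Q x p * E y P ≡ R Q y P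
  r̂-cleared = begin
    r̂ Q x p * E y P            ≡⟨ solve (Q ∷ x ∷ y ∷ p ∷ P ∷ []) ℚ-ring ⟩
    Rₕ Q y P (x * y) (p * P)   ≡⟨ cong₂ (Rₕ Q y P) xy≡1 pP≡1 ⟩
    Rₕ Q y P 1ℚ 1ℚ             ≡⟨ solve (Q ∷ y ∷ P ∷ []) ℚ-ring ⟩
    R Q y P                    ∎

  û-cleared : û Q x p * E y P ≡ U Q y P
  û-cleared = begin
    û Q x p * E y P            ≡⟨ solve (Q ∷ x ∷ y ∷ p ∷ P ∷ []) ℚ-ring ⟩
    Uₕ Q y P (x * y) (p * P)   ≡⟨ cong₂ (Uₕ Q y P) xy≡1 pP≡1 ⟩
    Uₕ Q y P 1ℚ 1ℚ             ≡⟨ solve (Q ∷ y ∷ P ∷ []) ℚ-ring ⟩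
    U Q y P                    ∎

module Clearing (m q : ℕ) (x y : ℚ) (xy≡1 : x * y ≡ 1ℚ) where
  private
    p P : ℚ
    p = x ^ℕ m
    P = y ^ℕ m

    x^kℓ : ∀ k → x ^ℕ (k ℕ.* suc m) ≡ (x * p) ^ k
    x^kℓ = ^ℕ-*-exponent x (suc m)

    x^kℓ+1 : ∀ k → x ^ℕ (k ℕ.* suc m ℕ.+ 1) ≡ (x * p) ^ k * x
    x^kℓ+1 k = trans (^ℕ-+ x (k ℕ.* suc m) 1) (cong₂ _*_ (x^kℓ k) (*-identityʳ x))

    x^-n : ∀ n → x ^ℤ (0 ⊖ℤ n) ≡ y ^ℕ n
    x^-n zero = refl
    x^-n (suc n) = inv-unique (x ^ℕ suc n) (^ℕ-inverse x y xy≡1 (suc n))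

    x^1-n : ∀ n → x ^ℤ (1 ⊖ℤ suc n) ≡ y ^ℕ n
    x^1-n zero = refl
    x^1-n (suc n) = inv-unique (x ^ℕ suc n) (^ℕ-inverse x y xy≡1 (suc n))

    -- The exponent 2ℓ - 1 = 2m + 1 appearing in v.
    y^2m+1 : y ^ℕ (m ℕ.+ suc (m ℕ.+ 0)) ≡ y * P ^ 2
    y^2m+1 = begin
      y ^ℕ (m ℕ.+ suc (m ℕ.+ 0))   ≡⟨ ^ℕ-+ y m (suc (m ℕ.+ 0)) ⟩
      P * (y * y ^ℕ (m ℕ.+ 0))     ≡⟨ cong (λ k → P * (y * y ^ℕ k)) (ℕ.+-identityʳ m) ⟩
      P * (y * P)                  ≡⟨ x∙yz≈y∙xz P y P ⟩
      y * (P * P)                  ∎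
      where open ≡-Reasoning

  r-cleared : r (suc m) q x * E y P ≡ R (nat q) y P
  r-cleared = trans
    (cong (_* E y P) (cong₅ (λ a b c d e → nat q * a - b + c - nat q * d + e)
                        (x^kℓ+1 2) (x^kℓ 4) (x^kℓ 5) (x^kℓ+1 5) (x^kℓ 6)))
    (r̂-cleared {nat q} {x} {y} {p} {P} xy≡1 (^ℕ-inverse x y xy≡1 m))

  u-cleared : u (suc m) q x * E y P ≡ U (nat q) y P
  u-cleared = trans
    (cong (_* E y P) (cong₄ (λ a b c d → nat q * a - b + nat q * c - d)
                        (x^kℓ+1 4) (x^kℓ 5) (x^kℓ+1 5) (x^kℓ 6)))
    (û-cleared {nat q} {x} {y} {p} {P} xy≡1 (^ℕ-inverse x y xy≡1 m))

  s-cleared : s (suc m) q x ≡ S (nat q) y P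
  s-cleared = cong₂ (λ a b → 1ℚ - nat q * a + b) (x^1-n m) (x^-n (suc m))

  v-cleared : v (suc m) q x ≡ V (nat q) y P
  v-cleared = cong₄ (λ a b c d → 1ℚ - nat q * a + b - nat q * c + d)
    (x^1-n m) (x^-n (suc m)) (trans (x^1-n 2m+1) y^2m+1) (trans (x^-n (suc 2m+1)) (cong (y *_) y^2m+1))
    where 2m+1 = m ℕ.+ suc (m ℕ.+ 0)

module Estimates {Q y P : ℚ} (2≤Q : nat 2 ≤ Q) (Q≤y : Q ≤ y) (1≤P : 1ℚ ≤ P) where
  private
    0<Q : 0ℚ < Q
    0<Q = <-≤-trans (positive⁻¹ (nat 2)) 2≤Q

    [Q] : Cert Q
    [y] : Cert y
    [P] : Cert P
    [Q-2] : Cert (Q - nat 2)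
    [y-Q] : Cert (y - Q)
    [P-1] : Cert (P - 1ℚ)
    [Q] = >0 0<Q
    [y] = >0 (<-≤-trans 0<Q Q≤y)
    [P] = >0 (<-≤-trans (positive⁻¹ 1ℚ) 1≤P)
    [Q-2] = ≥0 (gap 2≤Q)
    [y-Q] = ≥0 (gap Q≤y)
    [P-1] = ≥0 (gap 1≤P)

    [yP-1] : Cert (y * (P - 1ℚ) + (y - Q) + (Q - nat 2) + nat 1)
    [QP-1] : Cert (Q * (P - 1ℚ) + (Q - nat 2) + nat 1)
    [yP-1] = [y] ⊗ [P-1] ⊕ [y-Q] ⊕ [Q-2] ⊕ # 1
    [QP-1] = [Q] ⊗ [P-1] ⊕ [Q-2] ⊕ # 1

  S-pos : 0ℚ < S Q y P
  S-pos = <-by (# 1 ⊕ [P] ⊗ [y-Q]) (solve (Q ∷ y ∷ P ∷ []) ℚ-ring)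

  V-pos : 0ℚ < V Q y P
  V-pos = <-by (# 1 ⊕ [P] ⊗ [y-Q] ⊕ [y] ⊗ [P] ⊛ 2 ⊗ [y-Q]) (solve (Q ∷ y ∷ P ∷ []) ℚ-ring)

  R-lower : y ^ 3 * P ^ 4 ≤ R Q y P
  R-lower = ≤-by ([Q-2] ⊗ [y] ⊛ 3 ⊗ [P] ⊛ 4
                  ⊕ [y] ⊛ 2 ⊗ [P] ⊛ 2 ⊗ ([y] ⊗ [P-1] ⊗ ([P] ⊕ # 1) ⊕ [y-Q] ⊕ [Q-2] ⊕ # 1)
                  ⊕ [P] ⊗ [y-Q] ⊕ # 1)
                 (solve (Q ∷ y ∷ P ∷ []) ℚ-ring)

  R-pos : 0ℚ < R Q y P
  R-pos = <-≤-trans (cert-pos ([y] ⊛ 3 ⊗ [P] ⊛ 4) _) R-lower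

  R-upper : R Q y P ≤ (Q + 1ℚ) * y ^ 3 * P ^ 4
  R-upper = ≤-by ([y] ⊛ 3 ⊗ [P] ⊛ 4 ⊕ [y] ⊗ [P] ⊗ [yP-1] ⊕ [QP-1]) (solve (Q ∷ y ∷ P ∷ []) ℚ-ring)

  S-upper : S Q y P ≤ nat 2 * y * P
  S-upper = ≤-by ([y] ⊗ [P] ⊕ [QP-1]) (solve (Q ∷ y ∷ P ∷ []) ℚ-ring)

  U-lower : y * P ^ 2 ≤ U Q y P
  U-lower = ≤-by ([Q-2] ⊗ [y] ⊗ [P] ⊛ 2 ⊕ [y] ⊗ [P] ⊗ [P-1] ⊕ [QP-1]) (solve (Q ∷ y ∷ P ∷ []) ℚ-ring)

  U-pos : 0ℚ < U Q y P
  U-pos = <-≤-trans (cert-pos ([y] ⊗ [P] ⊛ 2) _) U-lower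

  U-upper : U Q y P ≤ nat 2 * Q * y * P ^ 2
  U-upper = ≤-by ([Q] ⊗ [y] ⊗ [P] ⊛ 2 ⊕ [P] ⊗ [y-Q] ⊕ # 1) (solve (Q ∷ y ∷ P ∷ []) ℚ-ring)

  V-upper : V Q y P ≤ nat 3 * y ^ 2 * P ^ 2
  V-upper = ≤-by ([y] ⊛ 2 ⊗ [P] ⊛ 2 ⊕ [y] ⊗ [P] ⊗ [yP-1] ⊕ [Q] ⊗ [y] ⊗ [P] ⊛ 2 ⊕ [QP-1])
                 (solve (Q ∷ y ∷ P ∷ []) ℚ-ring)

  -- The hypotheses persist when y and P are squared.
  Q≤y² : Q ≤ y * y
  Q≤y² = ≤-by ([y] ⊗ [y-Q] ⊕ [Q] ⊗ ([y-Q] ⊕ [Q-2] ⊕ # 1)) (solve (Q ∷ y ∷ P ∷ []) ℚ-ring)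

  1≤P² : 1ℚ ≤ P * P
  1≤P² = ≤-by ([P-1] ⊗ ([P] ⊕ # 1)) (solve (Q ∷ y ∷ P ∷ []) ℚ-ring)

-- If a, b, d become A, B, D after multiplication by E², E and Y respectively (E = Y·M),
-- with A ≥ 0 and B > 0, then the cleared inequality A·g < B·D·M gives |a|·g < |b|·d.
cleared-comparison : ∀ {a b g d Y M A B D} → 0ℚ < Y → 0ℚ < M →
  a * (Y * M) ^ 2 ≡ A → b * (Y * M) ≡ B → d * Y ≡ D → 0ℚ ≤ A → 0ℚ < B →
  A * g < B * D * M → ∣ a ∣ * g < ∣ b ∣ * d
cleared-comparison {a} {b} {g} {d} {Y} {M} {A} {B} {D} 0<Y 0<M aE²≡A bE≡B dY≡D 0≤A 0<B Ag<BDM =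
  subst₂ _<_ (cong (_* g) (sym (0≤p⇒∣p∣≡p 0≤a))) (cong (_* d) (sym (0≤p⇒∣p∣≡p (<⇒≤ 0<b))))
    (*-cancelʳ-<-nonNeg ((Y * M) ^ 2) {{nonNegative (<⇒≤ 0<E²)}} cleared)
  where
  0<E : 0ℚ < Y * M
  0<E = *-pos 0<Y 0<M
  0<E² : 0ℚ < (Y * M) ^ 2
  0<E² = ^-pos 0<E 2
  0≤a : 0ℚ ≤ a
  0≤a = *-cancelʳ-nonNeg 0<E² (subst (0ℚ ≤_) (sym aE²≡A) 0≤A)
  0<b : 0ℚ < b
  0<b = *-cancelʳ-pos 0<E (subst (0ℚ <_) (sym bE≡B) 0<B)
  cleared : a * g * (Y * M) ^ 2 < b * d * (Y * M) ^ 2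
  cleared = begin-strict
    a * g * (Y * M) ^ 2         ≡⟨ solve (a ∷ g ∷ Y ∷ M ∷ []) ℚ-ring ⟩
    a * (Y * M) ^ 2 * g         ≡⟨ cong (_* g) aE²≡A ⟩
    A * g                       <⟨ Ag<BDM ⟩
    B * D * M                   ≡⟨ cong₂ (λ u w → u * w * M) (sym bE≡B) (sym dY≡D) ⟩
    b * (Y * M) * (d * Y) * M   ≡⟨ solve (b ∷ d ∷ Y ∷ M ∷ []) ℚ-ring ⟩
    b * d * (Y * M) ^ 2         ∎
    where open ≤-Reasoning

-- Comparison of consecutive terms at a sample point x = 1/y with y ≥ Q²: then y² exceeds Q by
-- a wide margin, and the cleared inequalities follow from the bounds of Estimates.
module Consecutive {Q y P : ℚ} (2≤Q : nat 2 ≤ Q) (Q²≤y : Q * Q ≤ y) (1≤P : 1ℚ ≤ P) where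
  private
    0<Q : 0ℚ < Q
    0<Q = <-≤-trans (positive⁻¹ (nat 2)) 2≤Q

    [Q] : Cert Q
    [Q-2] : Cert (Q - nat 2)
    [y-Q²] : Cert (y - Q * Q)
    [Q] = >0 0<Q
    [Q-2] = ≥0 (gap 2≤Q)
    [y-Q²] = ≥0 (gap Q²≤y)

  Q<y : Q < y
  Q<y = <-by ([y-Q²] ⊕ [Q] ⊗ ([Q-2] ⊕ # 1)) (solve (Q ∷ y ∷ []) ℚ-ring)

  private
    [y] : Cert y
    [P] : Cert P
    [y-Q] : Cert (y - Q)
    [P-1] : Cert (P - 1ℚ)
    [y] = >0 (<-trans 0<Q Q<y)
    [P] = >0 (<-≤-trans (positive⁻¹ 1ℚ) 1≤P)
    [y-Q] = ≥0 (gap (<⇒≤ Q<y))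
    [P-1] = ≥0 (gap 1≤P)

  y²≥8Q : nat 8 * Q ≤ y * y
  y²≥8Q = ≤-by ([y-Q²] ⊗ ([y] ⊕ [Q] ⊛ 2) ⊕ [Q] ⊗ [Q-2] ⊗ ([Q] ⊛ 2 ⊕ # 2 ⊗ [Q] ⊕ # 4))
               (solve (Q ∷ y ∷ []) ℚ-ring)

  private
    [y²-8Q] : Cert (y * y - nat 8 * Q)
    [y²-8Q] = ≥0 (gap y²≥8Q)

  r-margin : nat 2 * (Q + 1ℚ) < P * (y * y - Q)
  r-margin = <-by ([P-1] ⊗ ([y²-8Q] ⊕ # 7 ⊗ [Q]) ⊕ [y²-8Q] ⊕ # 5 ⊗ [Q-2] ⊕ # 8)
                  (solve (Q ∷ y ∷ P ∷ []) ℚ-ring)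

  u-margin : nat 6 * Q < y * P ^ 2 * (y * y - Q)
  u-margin = <-by (([y] ⊗ [P-1] ⊗ ([P] ⊕ # 1) ⊕ [y-Q] ⊕ [Q-2] ⊕ # 1) ⊗ ([y²-8Q] ⊕ # 7 ⊗ [Q])
                   ⊕ [y²-8Q] ⊕ [Q])
                  (solve (Q ∷ y ∷ P ∷ []) ℚ-ring)

  open Estimates 2≤Q (<⇒≤ Q<y) 1≤P
  private
    module Square = Estimates 2≤Q Q≤y² 1≤P²

    0≤y²-Q : 0ℚ ≤ y * y - Q
    0≤y²-Q = gap Q≤y²

    -- The cleared forms of |r(x²)|·s(x) < |r(x)|·(1 - Q x²) and of its analogue for u, v.
    r-cleared-ineq : R Q (y * y) (P * P) * S Q y P < R Q y P * (y * y - Q) * (y ^ 4 * P ^ 6)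
    r-cleared-ineq = begin-strict
      R Q (y * y) (P * P) * S Q y P
        ≤⟨ *-mono-≤-nonNeg (<⇒≤ Square.R-pos) Square.R-upper (cert-nonNeg (# 2 ⊗ [y] ⊗ [P])) S-upper ⟩
      (Q + 1ℚ) * (y * y) ^ 3 * (P * P) ^ 4 * (nat 2 * y * P)
        ≡⟨ solve (Q ∷ y ∷ P ∷ []) ℚ-ring ⟩
      nat 2 * (Q + 1ℚ) * (y ^ 7 * P ^ 9)
        <⟨ *-monoˡ-<-pos (y ^ 7 * P ^ 9) {{positive (cert-pos ([y] ⊛ 7 ⊗ [P] ⊛ 9) _)}} r-margin ⟩
      P * (y * y - Q) * (y ^ 7 * P ^ 9)
        ≡⟨ solve (Q ∷ y ∷ P ∷ []) ℚ-ring ⟩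
      y ^ 3 * P ^ 4 * (y * y - Q) * (y ^ 4 * P ^ 6)
        ≤⟨ *-monoʳ-≤-nonNeg (y ^ 4 * P ^ 6) {{nonNegative (cert-nonNeg ([y] ⊛ 4 ⊗ [P] ⊛ 6))}}
             (*-monoʳ-≤-nonNeg (y * y - Q) {{nonNegative 0≤y²-Q}} R-lower) ⟩
      R Q y P * (y * y - Q) * (y ^ 4 * P ^ 6)
        ∎
      where open ≤-Reasoning

    u-cleared-ineq : U Q (y * y) (P * P) * V Q y P < U Q y P * (y * y - Q) * (y ^ 4 * P ^ 6)
    u-cleared-ineq = begin-strict
      U Q (y * y) (P * P) * V Q y P
        ≤⟨ *-mono-≤-nonNeg (<⇒≤ Square.U-pos) Square.U-upper (cert-nonNeg (# 3 ⊗ [y] ⊛ 2 ⊗ [P] ⊛ 2)) V-upper ⟩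
      nat 2 * Q * (y * y) * (P * P) ^ 2 * (nat 3 * y ^ 2 * P ^ 2)
        ≡⟨ solve (Q ∷ y ∷ P ∷ []) ℚ-ring ⟩
      nat 6 * Q * (y ^ 4 * P ^ 6)
        <⟨ *-monoˡ-<-pos (y ^ 4 * P ^ 6) {{positive (cert-pos ([y] ⊛ 4 ⊗ [P] ⊛ 6) _)}} u-margin ⟩
      y * P ^ 2 * (y * y - Q) * (y ^ 4 * P ^ 6)
        ≤⟨ *-monoʳ-≤-nonNeg (y ^ 4 * P ^ 6) {{nonNegative (cert-nonNeg ([y] ⊛ 4 ⊗ [P] ⊛ 6))}}
             (*-monoʳ-≤-nonNeg (y * y - Q) {{nonNegative 0≤y²-Q}} U-lower) ⟩
      U Q y P * (y * y - Q) * (y ^ 4 * P ^ 6)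
        ∎
      where open ≤-Reasoning

    comparison : ∀ {a b g d A B} → a * E (y * y) (P * P) ≡ A → b * E y P ≡ B →
      d * (y * y) ≡ y * y - Q → 0ℚ ≤ A → 0ℚ < B → A * g < B * (y * y - Q) * (y ^ 4 * P ^ 6) →
      ∣ a ∣ * g < ∣ b ∣ * d
    comparison {a} {b} {g} {d} aE²≡A bE≡B =
      cleared-comparison {a} {b} {g} {d} (cert-pos ([y] ⊗ [y]) _) (cert-pos ([y] ⊛ 4 ⊗ [P] ⊛ 6) _)
        (trans (cong (a *_) E²≡) aE²≡A) (trans (cong (b *_) E≡) bE≡B)
      where
      E≡ : y * y * (y ^ 4 * P ^ 6) ≡ E y P
      E≡ = solve (y ∷ P ∷ []) ℚ-ring
      E²≡ : (y * y * (y ^ 4 * P ^ 6)) ^ 2 ≡ E (y * y) (P * P)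
      E²≡ = solve (y ∷ P ∷ []) ℚ-ring

  -- The comparison of consecutive terms, for r, s and for u, v: x = 1/y is the current
  -- point, x² = 1/y′ the next one, with y′ = y² and P′ = P².
  r-step : ∀ {a b g d y′ P′} → y′ ≡ y * y → P′ ≡ P * P → a * E y′ P′ ≡ R Q y′ P′ →
           b * E y P ≡ R Q y P → g ≡ S Q y P → d * y′ ≡ y′ - Q → ∣ a ∣ * g < ∣ b ∣ * d
  r-step {a} {b} {g} {d} refl refl aE² bE refl dY =
    comparison {a} {b} {g} {d} aE² bE dY (<⇒≤ Square.R-pos) R-pos r-cleared-ineq

  u-step : ∀ {a b g d y′ P′} → y′ ≡ y * y → P′ ≡ P * P → a * E y′ P′ ≡ U Q y′ P′ →
           b * E y P ≡ U Q y P → g ≡ V Q y P → d * y′ ≡ y′ - Q → ∣ a ∣ * g < ∣ b ∣ * d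
  u-step {a} {b} {g} {d} refl refl aE² bE refl dY =
    comparison {a} {b} {g} {d} aE² bE dY (<⇒≤ Square.U-pos) U-pos u-cleared-ineq

signed-ratio : (a b c : ℕ → ℚ) → ℕ → ℚ
signed-ratio a b c i = ((- 1ℚ) ^ℕ i * a i * prod i b) * inv (prod (suc i) c)

prod-pos : ∀ {f} → (∀ j → 0ℚ < f j) → ∀ n → 0ℚ < prod n f
prod-pos 0<f zero = positive⁻¹ 1ℚ
prod-pos 0<f (suc n) = *-pos (prod-pos 0<f n) (0<f n)

∣signed∣ : ∀ n v {w z} → 0ℚ ≤ w → 0ℚ ≤ z → ∣ (- 1ℚ) ^ℕ n * v * w * z ∣ ≡ ∣ v ∣ * w * z
∣signed∣ n v {w} {z} 0≤w 0≤z = begin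
  ∣ (- 1ℚ) ^ℕ n * v * w * z ∣              ≡⟨ ∣p*q∣≡∣p∣*∣q∣ ((- 1ℚ) ^ℕ n * v * w) z ⟩
  ∣ (- 1ℚ) ^ℕ n * v * w ∣ * ∣ z ∣           ≡⟨ cong (_* ∣ z ∣) (∣p*q∣≡∣p∣*∣q∣ ((- 1ℚ) ^ℕ n * v) w) ⟩
  ∣ (- 1ℚ) ^ℕ n * v ∣ * ∣ w ∣ * ∣ z ∣       ≡⟨ cong (λ t → t * ∣ w ∣ * ∣ z ∣) (∣p*q∣≡∣p∣*∣q∣ ((- 1ℚ) ^ℕ n) v) ⟩
  ∣ (- 1ℚ) ^ℕ n ∣ * ∣ v ∣ * ∣ w ∣ * ∣ z ∣   ≡⟨ cong₄ (λ s t u o → s * t * u * o)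
                                                  (∣-1^n∣ n) refl (0≤p⇒∣p∣≡p 0≤w) (0≤p⇒∣p∣≡p 0≤z) ⟩
  1ℚ * ∣ v ∣ * w * z                        ≡⟨ cong (λ t → t * w * z) (*-identityˡ ∣ v ∣) ⟩
  ∣ v ∣ * w * z                             ∎
  where
  open ≡-Reasoning
  ∣-1^n∣ : ∀ k → ∣ (- 1ℚ) ^ℕ k ∣ ≡ 1ℚ
  ∣-1^n∣ zero = refl
  ∣-1^n∣ (suc k) = trans (∣p*q∣≡∣p∣*∣q∣ (- 1ℚ) ((- 1ℚ) ^ℕ k)) (cong (∣ - 1ℚ ∣ *_) (∣-1^n∣ k))

-- |signed-ratio| decreases at i as soon as |a(i+1)|·b(i) < |a(i)|·c(i+1), since the
-- quotient of consecutive terms is  -a(i+1)·b(i) / (a(i)·c(i+1)).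
ratio-criterion : ∀ a b c → (∀ j → 0ℚ < b j) → (∀ k → 0ℚ < c k) → ∀ i →
  ∣ a (suc i) ∣ * b i < ∣ a i ∣ * c (suc i) →
  ∣ signed-ratio a b c (suc i) ∣ < ∣ signed-ratio a b c i ∣
ratio-criterion a b c 0<b 0<c i hyp =
  *-cancelʳ-<-nonNeg (D * c′) {{nonNegative (<⇒≤ 0<Dc′)}} (begin-strict
    ∣ signed-ratio a b c (suc i) ∣ * (D * c′)
      ≡⟨ cong (_* (D * c′)) (∣signed∣ (suc i) (a (suc i)) (<⇒≤ 0<Πb) (<⇒≤ (inv-pos 0<Dc′))) ⟩
    ∣ a (suc i) ∣ * (Π * b i) * inv (D * c′) * (D * c′)
      ≡⟨ *-inv-cancel (∣ a (suc i) ∣ * (Π * b i)) 0<Dc′ ⟩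
    ∣ a (suc i) ∣ * (Π * b i)
      ≡⟨ x∙yz≈xz∙y ∣ a (suc i) ∣ Π (b i) ⟩
    ∣ a (suc i) ∣ * b i * Π
      <⟨ *-monoˡ-<-pos Π {{positive 0<Π}} hyp ⟩
    ∣ a i ∣ * c′ * Π
      ≡⟨ xy∙z≈xz∙y ∣ a i ∣ c′ Π ⟩
    ∣ a i ∣ * Π * c′
      ≡⟨ cong (_* c′) (sym (*-inv-cancel (∣ a i ∣ * Π) 0<D)) ⟩
    ∣ a i ∣ * Π * inv D * D * c′
      ≡⟨ *-assoc (∣ a i ∣ * Π * inv D) D c′ ⟩
    ∣ a i ∣ * Π * inv D * (D * c′)
      ≡⟨ cong (_* (D * c′)) (sym (∣signed∣ i (a i) (<⇒≤ 0<Π) (<⇒≤ (inv-pos 0<D)))) ⟩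
    ∣ signed-ratio a b c i ∣ * (D * c′)
      ∎)
  where
  open ≤-Reasoning
  Π D c′ : ℚ
  Π = prod i b
  D = prod (suc i) c
  c′ = c (suc i)
  0<Π : 0ℚ < Π
  0<Π = prod-pos 0<b i
  0<Πb : 0ℚ < Π * b i
  0<Πb = prod-pos 0<b (suc i)
  0<D : 0ℚ < D
  0<D = prod-pos 0<c (suc i)
  0<Dc′ : 0ℚ < D * c′
  0<Dc′ = prod-pos 0<c (suc (suc i))

^ℤ-neg-inverse : ∀ {z} → 0ℚ < z → ∀ n → z ^ℤ (0 ⊖ℤ n) * z ^ℕ n ≡ 1ℚ
^ℤ-neg-inverse 0<z zero = refl
^ℤ-neg-inverse 0<z (suc n) = inv-cancelˡ (pos⇒≢0 (^ℕ-pos 0<z (suc n)))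

1-z^[1-N] : ∀ {z} → 0ℚ < z → ∀ {N} → 2 ℕ.≤ N → (1ℚ - z ^ℤ (1 ⊖ℤ N)) * z ^ℕ N ≡ z ^ℕ N - z
1-z^[1-N] {z} 0<z (s≤s (s≤s {n = k} _)) = begin
  (1ℚ - inv w) * (z * w)      ≡⟨ expand z w (inv w) ⟩
  z * w - z * (inv w * w)     ≡⟨ cong (λ t → z * w - z * t) (inv-cancelˡ (pos⇒≢0 (^ℕ-pos 0<z (suc k)))) ⟩
  z * w - z * 1ℚ              ≡⟨ cong (λ t → z * w - t) (*-identityʳ z) ⟩
  z * w - z                   ∎
  where
  open ≡-Reasoning
  w : ℚ
  w = z ^ℕ suc k
  expand : ∀ z w i → (1ℚ - i) * (z * w) ≡ z * w - z * (i * w)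
  expand z w i = solve (z ∷ w ∷ i ∷ []) ℚ-ring

^ℕ-≥-square : ∀ {z} → 1ℚ ≤ z → ∀ {N} → 2 ℕ.≤ N → z * z ≤ z ^ℕ N
^ℕ-≥-square {z} 1≤z (s≤s (s≤s {n = k} _)) =
  *-monoˡ-≤-nonNeg z {{nonNegative 0≤z}} (subst (_≤ z * z ^ℕ k) (*-identityʳ z)
    (*-monoˡ-≤-nonNeg z {{nonNegative 0≤z}} (^ℕ-≥1 1≤z k)))
  where
  0≤z : 0ℚ ≤ z
  0≤z = ≤-trans (nonNegative⁻¹ 1ℚ) 1≤z

module Sequence (m q : ℕ) (2≤q : 2 ℕ.≤ q) where
  private
    Q : ℚ
    Q = nat q

    N : ℕ → ℕ
    N j = 2 ℕ.^ (j ℕ.+ 1)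

    y P c : ℕ → ℚ
    y j = Q ^ℕ N j
    P j = y j ^ℕ m
    c k = 1ℚ - Q ^ℤ (1 ⊖ℤ N k)

    2≤Q : nat 2 ≤ Q
    2≤Q = nat-mono 2≤q

    1≤Q : 1ℚ ≤ Q
    1≤Q = ≤-trans (nat-mono {1} {2} (s≤s z≤n)) 2≤Q

    0<Q : 0ℚ < Q
    0<Q = <-≤-trans (positive⁻¹ 1ℚ) 1≤Q

    N≥2 : ∀ j → 2 ℕ.≤ N j
    N≥2 j = ℕ.^-monoʳ-≤ 2 (ℕ.m≤n+m 1 j)

    Q²≤y : ∀ j → Q * Q ≤ y j
    Q²≤y j = ^ℕ-≥-square 1≤Q (N≥2 j)

    1≤P : ∀ j → 1ℚ ≤ P j
    1≤P j = ^ℕ-≥1 (^ℕ-≥1 1≤Q (N j)) m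

    Q<y : ∀ j → Q < y j
    Q<y j = Consecutive.Q<y 2≤Q (Q²≤y j) (1≤P j)

    pt·y : ∀ j → pt (suc m) q j * y j ≡ 1ℚ
    pt·y j = ^ℤ-neg-inverse 0<Q (N j)

    y-square : ∀ i → y (suc i) ≡ y i * y i
    y-square i = trans (^ℕ-+ Q (N i) (N i ℕ.+ 0)) (cong (λ k → y i * Q ^ℕ k) (ℕ.+-identityʳ (N i)))

    P-square : ∀ i → P (suc i) ≡ P i * P i
    P-square i = trans (cong (_^ℕ m) (y-square i)) (^ℕ-distrib-* (y i) (y i) m)

    c·y : ∀ k → c k * y k ≡ y k - Q
    c·y k = 1-z^[1-N] 0<Q (N≥2 k)

    c-pos : ∀ k → 0ℚ < c k
    c-pos k = *-cancelʳ-pos (^ℕ-pos 0<Q (N k)) (subst (0ℚ <_) (sym (c·y k)) (gap< (Q<y k)))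

    rₚ sₚ uₚ vₚ : ℕ → ℚ
    rₚ j = r (suc m) q (pt (suc m) q j)
    sₚ j = s (suc m) q (pt (suc m) q j)
    uₚ j = u (suc m) q (pt (suc m) q j)
    vₚ j = v (suc m) q (pt (suc m) q j)

    module At (j : ℕ) = Clearing m q (pt (suc m) q j) (y j) (pt·y j)

    sₚ-pos : ∀ j → 0ℚ < sₚ j
    sₚ-pos j = subst (0ℚ <_) (sym (At.s-cleared j)) (Estimates.S-pos 2≤Q (<⇒≤ (Q<y j)) (1≤P j))

    vₚ-pos : ∀ j → 0ℚ < vₚ j
    vₚ-pos j = subst (0ℚ <_) (sym (At.v-cleared j)) (Estimates.V-pos 2≤Q (<⇒≤ (Q<y j)) (1≤P j))

    module Step (i : ℕ) = Consecutive 2≤Q (Q²≤y i) (1≤P i)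

  G-decreasing : ∀ i → ∣ G (suc m) q (suc i) ∣ < ∣ G (suc m) q i ∣
  G-decreasing i = ratio-criterion rₚ sₚ c sₚ-pos c-pos i
    (Step.r-step i {rₚ (suc i)} {rₚ i} {sₚ i} {c (suc i)} (y-square i) (P-square i)
      (At.r-cleared (suc i)) (At.r-cleared i) (At.s-cleared i) (c·y (suc i)))

  H-decreasing : ∀ i → ∣ H (suc m) q (suc i) ∣ < ∣ H (suc m) q i ∣
  H-decreasing i = ratio-criterion uₚ vₚ c vₚ-pos c-pos i
    (Step.u-step i {uₚ (suc i)} {uₚ i} {vₚ i} {c (suc i)} (y-square i) (P-square i)
      (At.u-cleared (suc i)) (At.u-cleared i) (At.v-cleared i) (c·y (suc i)))

-- The theorem; the comparison holds from i = 0 on.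
lemmaA2 : (ℓ q : ℕ) → ℓ ≥ 1 → q ≥ 2 → ((i : ℕ) → i ≥ 1 → ∣ G ℓ q (suc i) ∣ < ∣ G ℓ q i ∣) × ((i : ℕ) → i ≥ 1 → ∣ H ℓ q (suc i) ∣ < ∣ H ℓ q i ∣)
lemmaA2 (suc m) q _ 2≤q = (λ i _ → G-decreasing i) , (λ i _ → H-decreasing i)
  where open Sequence m q 2≤q
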